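{- Let $\Gamma$ be a finite abelian group and let $\Lambda\subseteq\Gamma$. If $\Lambda$ satisfies the Erdős–Pósa condition, then there does not exist a $\Lambda$-obstruction.
   Context: Erdős–Pósa condition: (EP1) for all $a,b,c\in\Gamma$, if $a+b+c\in\Lambda$ then $a+b\in\Lambda$ or $(2a+\langle c\rangle)\cap\Lambda\ne\emptyset$ or $(2b+\langle c\rangle)\cap\Lambda\ne\emptyset$; and (EP2) for all $a,b,c\in\Gamma$, if $2a+b+c\in\Lambda$ then $(2a+\langle b\rangle)\cap\Lambda\ne\emptyset$ or $(2a+\langle c\rangle)\cap\Lambda\ne\emptyset$. $\Gamma$-labelled graph $(G,\gamma)$: $G$ finite loopless, $\gamma:E(G)\to\Gamma$, $\gamma(H)=\sum_{e\in E(H)}\gamma(e)$. An $X$-path has $\ge1$ edge, both ends in $X$, no internal vertex in $X$; an $X$-$Y$-path has one end in $X$, one in $Y$, internally disjoint from $X\cup Y$. Walls: a $(c,r)$-wall ($c,r\ge3$) is a subdivision of the elementary $(c,r)$-wall (obtained from the graph on $[2c]\times[r]$ with edges $(i,j)(i+1,j)$ and, when $i+j$ odd, $(i,j)(i,j+1)$, deleting the two degree-1 vertices), with fixed nail set $N^W$ (branch vertices), rows $R_j^W$ (second coordinate $j$), columns $C_i^W$ (first coordinate in $\{2i-1,2i\}$), order $\min\{c,r\}$. $\partial N^W$: nails on $C_1\cup C_c\cup R_1\cup R_r$; column-boundary: nails on $C_1\cup C_c$; $\prec_W$: the linear order on $\partial N^W$ restricting the cyclic boundary order with corner $C_1\cap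 R_1$ minimum and corners $C_1\cap R_1,C_1\cap R_r,C_c\cap R_r,C_c\cap R_1$ in that order. Strongly balanced: every $N^W$-path in $W$ has $\gamma$-length 0. A $W$-handle is a path with $\ge1$ edge, not an edge of $W$, with both ends in the column-boundary and no internal vertex in $W$. Endpoint pairs $\{x_1\prec x_2\},\{y_1\prec y_2\}$: in series if $x_2\prec y_1$ or $y_2\prec x_1$; nested if one lies strictly inside the other; crossing otherwise. A $W$-handlebar is a set $\mathcal{P}$ of pairwise disjoint $W$-handles whose endpoint pairs are pairwise in series, or pairwise nested, or pairwise crossing (accordingly $\mathcal{P}$ is in series/nested/crossing), with paths $R,R'\subseteq C_1\cup C_c$ such that each handle is a $V(R)$-$V(R')$-path; $U(\mathcal{P})=V(R\cup R')$ minimal. For $A\cap V(W)=\emptyset$, an $A$-$W$-handlebar is a set $\mathcal{Q}$ of disjoint $A$-$V(W)$-paths ending in the column-boundary, all in $V(C_1)$ or all in $V(C_c)$; $U(\mathcal{Q})=V(R)$ for a minimal path $R\subseteq C_1\cup C_c$ containing these ends. Non-mixing: disjoint $U$-sets. An $(A,k)$-ribboned wall $\mathcal{R}=(W,(\mathcal{P}_i:i\in[m]),\mathcal{Q}_1,\mathcal{Q}_2,\gamma)$: $W$ a wall of order $\ge k(m+2)$, $W$-handlebars $\mathcal{P}_i$, $A$-$W$-handlebars $\mathcal{Q}_j$, $\gamma$ a $\Gamma$-labelling of the union $G(\mathcal{R})$ of $W$ and these paths, with (A1) $\mathcal{Q}_1,\mathcal{Q}_2$ disjoint or equal, $\mathcal{P}_1,\dots,\mathcal{P}_m,\mathcal{Q}_1\cup\mathcal{Q}_2$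 pairwise disjoint and non-mixing ($U(\mathcal{Q}_1\cup\mathcal{Q}_2)=U(\mathcal{Q}_1)\cup U(\mathcal{Q}_2)$), $|\mathcal{P}_i|\ge k$, $|\mathcal{Q}_j|\ge2k$; (A2) $W$ strongly balanced and there are $g_i,h_j\in\Gamma$ with all paths in $\mathcal{P}_i$ of $\gamma$-length $g_i$ and all in $\mathcal{Q}_j$ of $\gamma$-length $h_j$. A $\Lambda$-obstruction is such an $\mathcal{R}$ (for some $A$, $k$) also satisfying: (A3) $\sum_ig_i+h_1+h_2\in\Lambda$; (A4) for all $i\in[m]$ and $b_1,b_2\in\{0,1,2\}$ with $b_1+b_2=2$, $(\langle g_j:j\ne i\rangle+b_1h_1+b_2h_2)\cap\Lambda=\emptyset$; (A5) for all such $b_1,b_2$, if $\sum_ic_ig_i+b_1h_1+b_2h_2\in\Lambda$ with $c_i\in\mathbb{Z}$, then each $\mathcal{P}_i$ is in series or $c_i$ is odd; (A6) some $\mathcal{P}_i$ is in series; (A7) if $m=1$, then $(\langle g_1\rangle+2h_j)\cap\Lambda=\emptyset$ for both $j\in[2]$. -}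

module Defs where

open import Level using (0ℓ)
open import Algebra.Bundles using (AbelianGroup)
open import Data.Nat using (ℕ; zero; suc; _+_; _*_; _∸_; _≤_; _<_; _/_; _%_; _⊓_; _⊔_; _≡ᵇ_)
open import Data.Integer using (ℤ; +_; -[1+_]; ∣_∣)
open import Data.Fin using (Fin)
open import Data.Product using (Σ; ∃; ∃-syntax; _×_; _,_; proj₁; proj₂)
open import Data.Sum using (_⊎_)
open import Data.Unit using (⊤)
open import Data.List using (List; []; _∷_)
open import Data.List.Membership.Propositional using (_∈_; _∉_)
open import Data.List.Relation.Unary.Unique.Propositional using (Unique)
open import Data.Bool using (if_then_else_)
open import Relation.Nullary using (¬_)
open import Relation.Binary.PropositionalEquality using (_≡_; _≢_)

record Graph : Set where
  field
    nV nE    : ℕ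
    ends     : Fin nE → Fin nV × Fin nV
    loopless : ∀ e → proj₁ (ends e) ≢ proj₂ (ends e)

module _ (G : Graph) where
  open Graph G

  Vtx : Set
  Vtx = Fin nV

  Edg : Set
  Edg = Fin nE

  Joins : Edg → Vtx → Vtx → Set
  Joins e u w = (ends e ≡ (u , w)) ⊎ (ends e ≡ (w , u))

  data Walk : Vtx → Vtx → Set where
    nil  : (v : Vtx) → Walk v v
    cons : {u w v : Vtx} (e : Edg) → Joins e u w → Walk w v → Walk u v

  wverts : {u v : Vtx} → Walk u v → List Vtx
  wverts (nil v)          = v ∷ []
  wverts (cons {u} e _ p) = u ∷ wverts p

  wedges : {u v : Vtx} → Walk u v → List Edg
  wedges (nil v)       = []
  wedges (cons e _ p)  = e ∷ wedges p

  record Path : Set where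
    field
      from to  : Vtx
      walk     : Walk from to
      distinct : Unique (wverts walk)

  verts : Path → List Vtx
  verts p = wverts (Path.walk p)

  edges : Path → List Edg
  edges p = wedges (Path.walk p)

  Internal : Path → Vtx → Set
  Internal p w = (w ∈ verts p) × (w ≢ Path.from p) × (w ≢ Path.to p)

  DisjointPaths : Path → Path → Set
  DisjointPaths p q = ∀ w → w ∈ verts p → w ∉ verts q

-- The elementary (c,r)-wall, with 0-based coordinates:
-- vertex (x , y) here is the vertex (x+1 , y+1) of the paper,
-- so x < 2c, y < r; (i+j odd) iff (x+y odd).

Coord : Set
Coord = ℕ × ℕ

InGrid : ℕ → ℕ → Coord → Set
InGrid c r (x , y) = (x < 2 * c) × (y < r)

HStep : Coord → Coord → Set
HStep (x , y) (x' , y') = (x' ≡ suc x) × (y' ≡ y)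

VStep : Coord → Coord → Set
VStep (x , y) (x' , y') = (x' ≡ x) × (y' ≡ suc y) × ((x + y) % 2 ≡ 1)

-- adjacency in the graph on [2c] × [r] (before deleting degree-1 vertices)
GridAdj : ℕ → ℕ → Coord → Coord → Set
GridAdj c r u v = InGrid c r u × InGrid c r v ×
                  (HStep u v ⊎ HStep v u ⊎ VStep u v ⊎ VStep v u)

Deg1 : ℕ → ℕ → Coord → Set
Deg1 c r u = ∃[ w ] (GridAdj c r u w × (∀ w' → GridAdj c r u w' → w' ≡ w))

WV : ℕ → ℕ → Coord → Set
WV c r u = InGrid c r u × ¬ Deg1 c r u

-- edges of the elementary wall, named by their lower/left end and a direction
data Dir : Set where
  hor ver : Dir

EIx : Set
EIx = Coord × Dir

src : EIx → Coord
src (u , _) = u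

tgt : EIx → Coord
tgt ((x , y) , hor) = (suc x , y)
tgt ((x , y) , ver) = (x , suc y)

EE : ℕ → ℕ → EIx → Set
EE c r ((x , y) , hor) = WV c r (x , y) × WV c r (suc x , y)
EE c r ((x , y) , ver) = WV c r (x , y) × WV c r (x , suc y) × ((x + y) % 2 ≡ 1)

-- 0-based column index: column C_i of the paper is colOf = i - 1
colOf : Coord → ℕ
colOf (x , _) = x / 2

ColE : ℕ → EIx → Set
ColE q e = (colOf (src e) ≡ q) × (colOf (tgt e) ≡ q)

BColE : ℕ → EIx → Set
BColE c e = ColE 0 e ⊎ ColE (c ∸ 1) e

CB : ℕ → ℕ → Coord → Set
CB c r u = WV c r u × ((colOf u ≡ 0) ⊎ (colOf u ≡ c ∸ 1))

-- Position of a column-boundary vertex in the linear order ≺_W: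
-- traversing C_1 from its bottom (corner C_1 ∩ R_1) upwards, then
-- (after the top row) C_c from top to bottom.  'key' is the position
-- of (x , y) when its column is traversed bottom-up.
key : Coord → ℕ
key (x , y) = 2 * y + ((x % 2) + y) % 2

rank : ℕ → ℕ → Coord → ℕ
rank c r u = if colOf u ≡ᵇ 0 then key u else (4 * r + 4) ∸ key u

record Wall (G : Graph) (c r : ℕ) : Set where
  field
    nail      : Coord → Vtx G
    nail-inj  : ∀ u v → WV c r u → WV c r v → nail u ≡ nail v → u ≡ v
    sub       : EIx → Path G
    sub-from  : ∀ e → EE c r e → Path.from (sub e) ≡ nail (src e)
    sub-to    : ∀ e → EE c r e → Path.to (sub e) ≡ nail (tgt e)
    sub-nails : ∀ e → EE c r e → ∀ w → Internal G (sub e) w →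
                ∀ u → WV c r u → nail u ≢ w
    sub-disj  : ∀ e e' → EE c r e → EE c r e' → e ≢ e' →
                ∀ w → Internal G (sub e) w → w ∉ verts G (sub e')

module _ {G : Graph} {c r : ℕ} (W : Wall G c r) where
  open Wall W

  InVS : (EIx → Set) → Vtx G → Set
  InVS S w = ∃[ e ] (EE c r e × S e × w ∈ verts G (sub e))

  InES : (EIx → Set) → Edg G → Set
  InES S f = ∃[ e ] (EE c r e × S e × f ∈ edges G (sub e))

  InV : Vtx G → Set
  InV = InVS (λ _ → ⊤)

  InE : Edg G → Set
  InE = InES (λ _ → ⊤)

  IsNail : Vtx G → Set
  IsNail w = ∃[ u ] (WV c r u × nail u ≡ w)

  InBoundaryCols : Path G → Set
  InBoundaryCols p = (∀ f → f ∈ edges G p → InES (BColE c) f) ×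
                     (∀ w → w ∈ verts G p → InVS (BColE c) w)

  record Handle : Set where
    field
      path     : Path G
      su sv    : Coord
      su-cb    : CB c r su
      sv-cb    : CB c r sv
      from-eq  : Path.from path ≡ nail su
      to-eq    : Path.to path ≡ nail sv
      nonempty : edges G path ≢ []
      notWEdge : ¬ (∃[ f ] ((edges G path ≡ f ∷ []) × InE f))
      inner    : ∀ w → Internal G path w → ¬ InV w

  lo : Handle → ℕ
  lo h = rank c r (Handle.su h) ⊓ rank c r (Handle.sv h)

  hi : Handle → ℕ
  hi h = rank c r (Handle.su h) ⊔ rank c r (Handle.sv h)

  Series : Handle → Handle → Set
  Series h h' = (hi h < lo h') ⊎ (hi h' < lo h)

  Nested : Handle → Handle → Set
  Nested h h' = ((lo h < lo h') × (hi h' < hi h)) ⊎ ((lo h' < lo h) × (hi h < hi h'))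

  Crossing : Handle → Handle → Set
  Crossing h h' = ¬ Series h h' × ¬ Nested h h'

  data Kind : Set where
    series nested crossing : Kind

  KindRel : Kind → Handle → Handle → Set
  KindRel series   = Series
  KindRel nested   = Nested
  KindRel crossing = Crossing

  Links : Path G → Path G → Path G → Set
  Links R R' p =
    (((Path.from p ∈ verts G R) × (Path.to p ∈ verts G R')) ⊎
     ((Path.from p ∈ verts G R') × (Path.to p ∈ verts G R))) ×
    (∀ w → Internal G p w → (w ∉ verts G R) × (w ∉ verts G R'))

  UU : Path G → Path G → Vtx G → Set
  UU R R' w = (w ∈ verts G R) ⊎ (w ∈ verts G R')

  -- W-handlebars; U(P) = V(R ∪ R') for an inclusion-minimal choice of R, R'
  record Handlebar : Set where
    field
      size     : ℕ
      handle   : Fin size → Handle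
      disjoint : ∀ i j → i ≢ j →
                 DisjointPaths G (Handle.path (handle i)) (Handle.path (handle j))
      kind     : Kind
      kinded   : ∀ i j → i ≢ j → KindRel kind (handle i) (handle j)
      R R'     : Path G
      R-in     : InBoundaryCols R
      R'-in    : InBoundaryCols R'
      links    : ∀ i → Links R R' (Handle.path (handle i))
      minimal  : ∀ S S' → InBoundaryCols S → InBoundaryCols S' →
                 (∀ i → Links S S' (Handle.path (handle i))) →
                 (∀ w → UU S S' w → UU R R' w) →
                 ∀ w → UU R R' w → UU S S' w

  UP : Handlebar → Vtx G → Set
  UP P = UU (Handlebar.R P) (Handlebar.R' P)

  hpath : (P : Handlebar) → Fin (Handlebar.size P) → Path G
  hpath P i = Handle.path (Handlebar.handle P i)

  InSeries : Handlebar → Set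
  InSeries P = ∀ i j → i ≢ j →
               Series (Handlebar.handle P i) (Handlebar.handle P j)

  record AWHandlebar (A : Vtx G → Set) : Set where
    field
      size     : ℕ
      path     : Fin size → Path G
      starts   : ∀ i → A (Path.from (path i))
      tc       : Fin size → Coord
      tc-cb    : ∀ i → CB c r (tc i)
      to-eq    : ∀ i → Path.to (path i) ≡ nail (tc i)
      inner    : ∀ i w → Internal G (path i) w → ¬ A w × ¬ InV w
      disjoint : ∀ i j → i ≢ j → DisjointPaths G (path i) (path j)
      side     : (∀ i → InVS (ColE 0) (Path.to (path i))) ⊎
                 (∀ i → InVS (ColE (c ∸ 1)) (Path.to (path i)))
      R        : Path G
      R-in     : InBoundaryCols R
      R-has    : ∀ i → Path.to (path i) ∈ verts G R
      minimal  : ∀ S → InBoundaryCols S →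
                 (∀ i → Path.to (path i) ∈ verts G S) →
                 (∀ w → w ∈ verts G S → w ∈ verts G R) →
                 ∀ w → w ∈ verts G R → w ∈ verts G S

  UQ : {A : Vtx G → Set} → AWHandlebar A → Vtx G → Set
  UQ Q w = w ∈ verts G (AWHandlebar.R Q)

module _ (Γ : AbelianGroup 0ℓ 0ℓ) where
  open AbelianGroup Γ
  open import Algebra.Definitions.RawMonoid rawMonoid using (sum) renaming (_×_ to _·ℕ_)

  FiniteGroup : Set
  FiniteGroup = Σ ℕ λ n → Σ (Fin n → Carrier) λ f → ∀ x → ∃[ i ] (f i ≈ x)

  RespectsEq : (Carrier → Set) → Set
  RespectsEq Λ = ∀ {x y} → x ≈ y → Λ x → Λ y

  _·ℤ_ : ℤ → Carrier → Carrier
  (+ n)    ·ℤ x = n ·ℕ x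
  -[1+ n ] ·ℤ x = (suc n ·ℕ x) ⁻¹

  module _ (Λ : Carrier → Set) where

    CosetMeets : Carrier → Carrier → Set
    CosetMeets a c = ∃[ t ] Λ (a ∙ (t ·ℤ c))

    ErdosPosa : Set
    ErdosPosa =
      (∀ a b c → Λ ((a ∙ b) ∙ c) →
         Λ (a ∙ b) ⊎ CosetMeets (2 ·ℕ a) c ⊎ CosetMeets (2 ·ℕ b) c) ×
      (∀ a b c → Λ (((2 ·ℕ a) ∙ b) ∙ c) →
         CosetMeets (2 ·ℕ a) b ⊎ CosetMeets (2 ·ℕ a) c)

    len : (G : Graph) → (Edg G → Carrier) → Path G → Carrier
    len G γ p = go (edges G p)
      where
        go : List (Edg G) → Carrier
        go []       = ε
        go (f ∷ fs) = γ f ∙ go fs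

    record Obstruction : Set₁ where
      field
        G      : Graph
        γ      : Edg G → Carrier
        c r    : ℕ
        c≥3    : 3 ≤ c
        r≥3    : 3 ≤ r
        W      : Wall G c r
        A      : Vtx G → Set
        A∩W    : ∀ v → A v → ¬ InV W v
        k m    : ℕ
        order  : k * (m + 2) ≤ c ⊓ r
        P      : Fin m → Handlebar W
        Q₁ Q₂  : AWHandlebar W A
        Q-disj-or-eq : (Q₁ ≡ Q₂) ⊎
                       (∀ i j → DisjointPaths G (AWHandlebar.path Q₁ i)
                                                (AWHandlebar.path Q₂ j))
        PP-disj : ∀ i j → i ≢ j → ∀ a b →
                  DisjointPaths G (hpath W (P i) a) (hpath W (P j) b)
        PQ₁-disj : ∀ i a b →
                  DisjointPaths G (hpath W (P i) a) (AWHandlebar.path Q₁ b)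
        PQ₂-disj : ∀ i a b →
                  DisjointPaths G (hpath W (P i) a) (AWHandlebar.path Q₂ b)
        PP-nonmix : ∀ i j → i ≢ j → ∀ w → UP W (P i) w → ¬ UP W (P j) w
        PQ-nonmix : ∀ i w → UP W (P i) w → ¬ (UQ W Q₁ w ⊎ UQ W Q₂ w)
        P-size  : ∀ i → k ≤ Handlebar.size (P i)
        Q₁-size : 2 * k ≤ AWHandlebar.size Q₁
        Q₂-size : 2 * k ≤ AWHandlebar.size Q₂
        balanced : ∀ (p : Path G) → edges G p ≢ [] →
                   IsNail W (Path.from p) → IsNail W (Path.to p) →
                   (∀ w → Internal G p w → ¬ IsNail W w) →
                   (∀ f → f ∈ edges G p → InE W f) →
                   len G γ p ≈ ε
        g      : Fin m → Carrier
        h₁ h₂  : Carrier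
        P-len  : ∀ i a → len G γ (hpath W (P i) a) ≈ g i
        Q₁-len : ∀ a → len G γ (AWHandlebar.path Q₁ a) ≈ h₁
        Q₂-len : ∀ a → len G γ (AWHandlebar.path Q₂ a) ≈ h₂
        A3 : Λ ((sum g ∙ h₁) ∙ h₂)
        -- (A4): ⟨g_j : j ≠ i⟩ = { Σ_j c_j g_j : c_i = 0 }
        A4 : ∀ i (b₁ b₂ : ℕ) → b₁ + b₂ ≡ 2 → ∀ (cs : Fin m → ℤ) → cs i ≡ + 0 →
             ¬ Λ ((sum (λ j → cs j ·ℤ g j) ∙ (b₁ ·ℕ h₁)) ∙ (b₂ ·ℕ h₂))
        A5 : ∀ (b₁ b₂ : ℕ) → b₁ + b₂ ≡ 2 → ∀ (cs : Fin m → ℤ) →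
             Λ ((sum (λ j → cs j ·ℤ g j) ∙ (b₁ ·ℕ h₁)) ∙ (b₂ ·ℕ h₂)) →
             ∀ i → InSeries W (P i) ⊎ (∣ cs i ∣ % 2 ≡ 1)
        A6 : ∃[ i ] InSeries W (P i)
        A7 : m ≡ 1 → ∀ i (t : ℤ) →
             ¬ Λ ((t ·ℤ g i) ∙ (2 ·ℕ h₁)) × ¬ Λ ((t ·ℤ g i) ∙ (2 ·ℕ h₂))

-- Apply (EP1) to h₁ + h₂ + Σ gᵢ, which lies in Λ by (A3). The outcome h₁ + h₂ ∈ Λ is
-- excluded by (A4). Otherwise some 2hⱼ + t Σ gᵢ lies in Λ. If m = 1 this contradicts (A7);
-- if m ≥ 2, split t Σ gᵢ = t g₁ + t Σ_{i≥2} gᵢ and apply (EP2): every element of either coset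
-- 2hⱼ + ⟨t g₁⟩, 2hⱼ + ⟨t Σ_{i≥2} gᵢ⟩ has the form 2hⱼ + x with x in the span of all but one
-- gᵢ, so none of them lies in Λ, again by (A4). Only (A3), (A4), (A7) and m ≥ 1 (from (A6))
-- are needed; finiteness of Γ is not.
module Submission where

open import Defs
open import Level using (0ℓ)
open import Algebra.Bundles using (AbelianGroup)
open import Relation.Nullary using (¬_)
open import Data.Nat as ℕ using (ℕ; zero; suc)
open import Data.Integer using (ℤ; +_; -[1+_]; _*_; ∣_∣; sign; _◃_)
open import Data.Integer.Properties using (*-zeroʳ)
open import Data.Sign as Sign using (Sign)
open import Data.Fin using (Fin; zero; suc)
open import Data.Product using (Σ-syntax; _×_; _,_; proj₁; proj₂)
open import Data.Sum using ([_,_]′)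
open import Relation.Binary.PropositionalEquality as ≡ using (_≡_; refl)

module IntegerMultiples (Γ : AbelianGroup 0ℓ 0ℓ) where
  open AbelianGroup Γ renaming (refl to ≈-refl; sym to ≈-sym; trans to ≈-trans)
  open import Algebra.Definitions.RawMonoid rawMonoid using (sum) renaming (_×_ to _·ℕ_)
  open import Algebra.Properties.Group group using (ε⁻¹≈ε; ⁻¹-involutive)
  open import Algebra.Properties.AbelianGroup Γ using (⁻¹-∙-comm)
  open import Algebra.Properties.Monoid.Mult monoid using (×-congʳ; ×-assocˡ)
  open import Algebra.Properties.Monoid.Sum monoid using (sum-replicate; sum-replicate-zero)
  open import Algebra.Properties.CommutativeMonoid.Mult commutativeMonoid using (×-distrib-+)
  open import Relation.Binary.Reasoning.Setoid setoid

  infixr 8 _·_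
  _·_ : ℤ → Carrier → Carrier
  _·_ = _·ℤ_ Γ

  ·ℕ-identityʳ : ∀ n → n ·ℕ ε ≈ ε
  ·ℕ-identityʳ n = ≈-trans (≈-sym (sum-replicate n)) (sum-replicate-zero n)

  ·ℕ-⁻¹ : ∀ n x → n ·ℕ (x ⁻¹) ≈ (n ·ℕ x) ⁻¹
  ·ℕ-⁻¹ zero    x = ≈-sym ε⁻¹≈ε
  ·ℕ-⁻¹ (suc n) x = ≈-trans (∙-congˡ (·ℕ-⁻¹ n x)) (⁻¹-∙-comm x (n ·ℕ x))

  ·-cong : ∀ t {x y} → x ≈ y → t · x ≈ t · y
  ·-cong (+ n)    x≈y = ×-congʳ n x≈y
  ·-cong -[1+ n ] x≈y = ⁻¹-cong (×-congʳ (suc n) x≈y)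

  ·-identityʳ : ∀ t → t · ε ≈ ε
  ·-identityʳ (+ n)    = ·ℕ-identityʳ n
  ·-identityʳ -[1+ n ] = ≈-trans (⁻¹-cong (·ℕ-identityʳ (suc n))) ε⁻¹≈ε

  ·-distrib-∙ : ∀ t x y → t · (x ∙ y) ≈ t · x ∙ t · y
  ·-distrib-∙ (+ n)    x y = ×-distrib-+ x y n
  ·-distrib-∙ -[1+ n ] x y =
    ≈-trans (⁻¹-cong (×-distrib-+ x y (suc n))) (≈-sym (⁻¹-∙-comm _ _))

  ·-sum : ∀ t {n} (f : Fin n → Carrier) → t · sum f ≈ sum (λ j → t · f j)
  ·-sum t {zero}  f = ·-identityʳ t
  ·-sum t {suc n} f =
    ≈-trans (·-distrib-∙ t (f zero) _) (∙-congˡ (·-sum t (λ j → f (suc j))))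

  signed : Sign → Carrier → Carrier
  signed Sign.+ x = x
  signed Sign.- x = x ⁻¹

  signed-cong : ∀ σ {x y} → x ≈ y → signed σ x ≈ signed σ y
  signed-cong Sign.+ x≈y = x≈y
  signed-cong Sign.- x≈y = ⁻¹-cong x≈y

  signed-* : ∀ σ τ x → signed (σ Sign.* τ) x ≈ signed σ (signed τ x)
  signed-* Sign.+ τ      x = ≈-refl
  signed-* Sign.- Sign.+ x = ≈-refl
  signed-* Sign.- Sign.- x = ≈-sym (⁻¹-involutive x)

  ·ℕ-signed : ∀ n σ x → n ·ℕ signed σ x ≈ signed σ (n ·ℕ x)
  ·ℕ-signed n Sign.+ x = ≈-refl
  ·ℕ-signed n Sign.- x = ·ℕ-⁻¹ n x

  ·-signAbs : ∀ t x → t · x ≈ signed (sign t) (∣ t ∣ ·ℕ x)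
  ·-signAbs (+ n)    x = ≈-refl
  ·-signAbs -[1+ n ] x = ≈-refl

  ◃-· : ∀ σ n x → (σ ◃ n) · x ≈ signed σ (n ·ℕ x)
  ◃-· Sign.+ zero    x = ≈-refl
  ◃-· Sign.- zero    x = ≈-sym ε⁻¹≈ε
  ◃-· Sign.+ (suc n) x = ≈-refl
  ◃-· Sign.- (suc n) x = ≈-refl

  *-· : ∀ s t x → (s * t) · x ≈ s · t · x
  *-· s t x = begin
    (s * t) · x
      ≈⟨ ◃-· (σ Sign.* τ) (∣ s ∣ ℕ.* ∣ t ∣) x ⟩
    signed (σ Sign.* τ) ((∣ s ∣ ℕ.* ∣ t ∣) ·ℕ x)
      ≈⟨ signed-cong (σ Sign.* τ) (≈-sym (×-assocˡ x ∣ s ∣ ∣ t ∣)) ⟩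
    signed (σ Sign.* τ) (∣ s ∣ ·ℕ (∣ t ∣ ·ℕ x))
      ≈⟨ signed-* σ τ _ ⟩
    signed σ (signed τ (∣ s ∣ ·ℕ (∣ t ∣ ·ℕ x)))
      ≈⟨ signed-cong σ (≈-sym (·ℕ-signed ∣ s ∣ τ _)) ⟩
    signed σ (∣ s ∣ ·ℕ signed τ (∣ t ∣ ·ℕ x))
      ≈⟨ signed-cong σ (×-congʳ ∣ s ∣ (≈-sym (·-signAbs t x))) ⟩
    signed σ (∣ s ∣ ·ℕ (t · x))
      ≈⟨ ·-signAbs s (t · x) ⟨
    s · t · x ∎
    where
    σ τ : Sign
    σ = sign s
    τ = sign t

module Avoidance (Γ : AbelianGroup 0ℓ 0ℓ) where
  open AbelianGroup Γ hiding (refl) renaming (sym to ≈-sym; trans to ≈-trans)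
  open import Algebra.Definitions.RawMonoid rawMonoid using (sum) renaming (_×_ to _·ℕ_)
  open import Algebra.Properties.Monoid.Mult monoid using (×-homo-1)
  open import Algebra.Properties.Monoid.Sum monoid using (sum-cong-≋; sum-replicate-zero)
  open import Relation.Binary.Reasoning.Setoid setoid
  open IntegerMultiples Γ

  module _ {m : ℕ} (g : Fin m → Carrier) where

    SpanWithout : Fin m → Carrier → Set
    SpanWithout i x = Σ[ cs ∈ (Fin m → ℤ) ] (cs i ≡ + 0 × sum (λ j → cs j · g j) ≈ x)

    ε∈SpanWithout : ∀ i → SpanWithout i ε
    ε∈SpanWithout i = (λ _ → + 0) , refl , sum-replicate-zero m

    ·∈SpanWithout : ∀ s {i x} → SpanWithout i x → SpanWithout i (s · x)
    ·∈SpanWithout s {i} {x} (cs , csᵢ≡0 , Σ≈x) = (λ j → s * cs j) , s*csᵢ≡0 , Σ≈s·x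
      where
      s*csᵢ≡0 : s * cs i ≡ + 0
      s*csᵢ≡0 = ≡.trans (≡.cong (s *_) csᵢ≡0) (*-zeroʳ s)

      Σ≈s·x : sum (λ j → (s * cs j) · g j) ≈ s · x
      Σ≈s·x = begin
        sum (λ j → (s * cs j) · g j) ≈⟨ sum-cong-≋ (λ j → *-· s (cs j) (g j)) ⟩
        sum (λ j → s · cs j · g j)   ≈⟨ ·-sum s (λ j → cs j · g j) ⟨
        s · sum (λ j → cs j · g j)   ≈⟨ ·-cong s Σ≈x ⟩
        s · x                         ∎

  head∈SpanWithout : ∀ {m} (g : Fin (suc m) → Carrier) i → SpanWithout g (suc i) (g zero)
  head∈SpanWithout {m} g i = cs , refl , Σ≈g₀
    where
    cs : Fin (suc m) → ℤ
    cs zero    = + 1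
    cs (suc _) = + 0

    Σ≈g₀ : sum (λ j → cs j · g j) ≈ g zero
    Σ≈g₀ = ≈-trans (∙-cong (×-homo-1 (g zero)) (sum-replicate-zero m)) (identityʳ _)

  tail∈SpanWithout : ∀ {m} (g : Fin (suc m) → Carrier) →
                     SpanWithout g zero (sum (λ j → g (suc j)))
  tail∈SpanWithout {m} g = cs , refl , Σ≈tail
    where
    cs : Fin (suc m) → ℤ
    cs zero    = + 0
    cs (suc _) = + 1

    Σ≈tail : sum (λ j → cs j · g j) ≈ sum (λ j → g (suc j))
    Σ≈tail = ≈-trans (identityˡ _) (sum-cong-≋ (λ j → ×-homo-1 (g (suc j))))

  module _ (Λ : Carrier → Set) (resp : RespectsEq Γ Λ) where

    Condition-A4 : ∀ {m} → (Fin m → Carrier) → Carrier → Carrier → Set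
    Condition-A4 {m} g h₁ h₂ =
      ∀ i (b₁ b₂ : ℕ) → b₁ ℕ.+ b₂ ≡ 2 → ∀ (cs : Fin m → ℤ) → cs i ≡ + 0 →
      ¬ Λ (sum (λ j → cs j · g j) ∙ b₁ ·ℕ h₁ ∙ b₂ ·ℕ h₂)

    module _ {m} {g : Fin m → Carrier} {h₁ h₂ : Carrier} (A4 : Condition-A4 g h₁ h₂) where

      SpanWithout-avoidsΛ : ∀ {i x y} b₁ b₂ → b₁ ℕ.+ b₂ ≡ 2 → y ≈ b₁ ·ℕ h₁ ∙ b₂ ·ℕ h₂ →
                            SpanWithout g i x → ¬ Λ (y ∙ x)
      SpanWithout-avoidsΛ {i} {x} {y} b₁ b₂ b₁+b₂≡2 y≈ (cs , csᵢ≡0 , Σ≈x) Λyx =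
        A4 i b₁ b₂ b₁+b₂≡2 cs csᵢ≡0 (resp yx≈ Λyx)
        where
        yx≈ : y ∙ x ≈ sum (λ j → cs j · g j) ∙ b₁ ·ℕ h₁ ∙ b₂ ·ℕ h₂
        yx≈ = begin
          y ∙ x                                                ≈⟨ comm y x ⟩
          x ∙ y                                                ≈⟨ ∙-cong (≈-sym Σ≈x) y≈ ⟩
          sum (λ j → cs j · g j) ∙ (b₁ ·ℕ h₁ ∙ b₂ ·ℕ h₂)       ≈⟨ assoc _ _ _ ⟨
          sum (λ j → cs j · g j) ∙ b₁ ·ℕ h₁ ∙ b₂ ·ℕ h₂         ∎

      h₁∙h₂∉Λ : Fin m → ¬ Λ (h₁ ∙ h₂)
      h₁∙h₂∉Λ i Λh₁h₂ =
        SpanWithout-avoidsΛ 1 1 refl (∙-cong (≈-sym (identityʳ h₁)) (≈-sym (identityʳ h₂)))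
          (ε∈SpanWithout g i) (resp (≈-sym (identityʳ _)) Λh₁h₂)

    coset-of-sum-avoidsΛ :
      ErdosPosa Γ Λ → ∀ {m} {g : Fin m → Carrier} {h₁ h₂} → Condition-A4 g h₁ h₂ →
      ∀ a b₁ b₂ → b₁ ℕ.+ b₂ ≡ 2 → 2 ·ℕ a ≈ b₁ ·ℕ h₁ ∙ b₂ ·ℕ h₂ →
      (m ≡ 1 → ∀ i t → ¬ Λ (t · g i ∙ 2 ·ℕ a)) →
      Fin m → ¬ CosetMeets Γ Λ (2 ·ℕ a) (sum g)
    coset-of-sum-avoidsΛ _ {suc zero} {g} _ a _ _ _ _ A7 zero (t , Λ2a+t·g₀) =
      A7 refl zero t (resp (≈-trans (comm _ _) (∙-congʳ (·-cong t (identityʳ (g zero)))))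
                           Λ2a+t·g₀)
    coset-of-sum-avoidsΛ (_ , ep₂) {suc (suc n)} {g} A4 a b₁ b₂ b₁+b₂≡2 2a≈ _ _ (t , Λ2a+t·Σg) =
      [ (λ (s , l) → avoids (·∈SpanWithout g s (·∈SpanWithout g t (head∈SpanWithout g zero))) l)
      , (λ (s , l) → avoids (·∈SpanWithout g s (·∈SpanWithout g t (tail∈SpanWithout g))) l)
      ]′ (ep₂ a (t · g zero) (t · tail) (resp split Λ2a+t·Σg))
      where
      tail : Carrier
      tail = sum (λ j → g (suc j))

      avoids : ∀ {i x} → SpanWithout g i x → ¬ Λ (2 ·ℕ a ∙ x)
      avoids = SpanWithout-avoidsΛ {g = g} A4 b₁ b₂ b₁+b₂≡2 2a≈

      split : 2 ·ℕ a ∙ t · (g zero ∙ tail) ≈ 2 ·ℕ a ∙ t · g zero ∙ t · tail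
      split = ≈-trans (∙-congˡ (·-distrib-∙ t _ _)) (≈-sym (assoc _ _ _))

proposition3p6 : (Γ : AbelianGroup 0ℓ 0ℓ) → FiniteGroup Γ →
                 (Λ : AbelianGroup.Carrier Γ → Set) → RespectsEq Γ Λ →
                 ErdosPosa Γ Λ → ¬ Obstruction Γ Λ
proposition3p6 Γ _ Λ resp ep O =
  [ h₁∙h₂∉Λ Λ resp A4 i
  , [ coset-of-sum-avoidsΛ Λ resp ep A4 h₁ 2 0 refl (sym (identityʳ _))
        (λ m≡1 j t → proj₁ (A7 m≡1 j t)) i
    , coset-of-sum-avoidsΛ Λ resp ep A4 h₂ 0 2 refl (sym (identityˡ _))
        (λ m≡1 j t → proj₂ (A7 m≡1 j t)) i
    ]′
  ]′ (proj₁ ep h₁ h₂ _ (resp (trans (assoc _ _ _) (comm _ _)) A3))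
  where
  open Obstruction O
  open AbelianGroup Γ using (assoc; comm; identityˡ; identityʳ; sym; trans)
  open Avoidance Γ

  i : Fin m
  i = proj₁ A6
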